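{- Let $G$ be a finite simple graph. The leaf-removal procedure described below, applied to $G$, ends with the empty graph if and only if $G$ is a K\"{o}nig-Egerv\'{a}ry graph that has a unique perfect matching. In that case the set $M$ it outputs is the unique perfect matching of $G$.
   Context: For a graph $G$, $\alpha(G)$ is the maximum size of an independent set and $\mu(G)$ is the maximum size of a matching. $G$ is a K\"{o}nig-Egerv\'{a}ry graph if $\alpha(G)+\mu(G)=|V(G)|$. A perfect matching is a matching saturating every vertex. A leaf is a vertex of degree exactly $1$. The leaf-removal procedure (a variant of the Karp-Sipser algorithm) works as follows. Start with $M=\emptyset$ and the current graph equal to $G$. As long as the current graph has a leaf $w$, choose one, add to $M$ the edge joining $w$ to its only neighbor $u$, and delete both $w$ and $u$, together with all edges incident to them, from the current graph. The procedure stops when the current graph has no leaf, and it outputs $M$ together with the remaining graph. The procedure "ends with the empty graph" if the remaining graph has no vertices. -}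

module Defs where

open import Data.Nat using (ℕ; zero; suc; _+_; _<?_; _≤_)
open import Data.Fin using (Fin; zero; suc; toℕ; _≟_)
open import Data.Bool using (Bool; true; false; _∧_; not; if_then_else_)
open import Data.List using (List; []; _∷_)
open import Data.List.Membership.Propositional using (_∈_)
open import Data.Product using (_×_; _,_; ∃; Σ-syntax; ∃-syntax)
open import Data.Sum using (_⊎_)
open import Function.Bundles using (_⇔_)
open import Relation.Nullary using (¬_)
open import Relation.Nullary.Decidable using (⌊_⌋)
open import Relation.Binary.PropositionalEquality using (_≡_)

record Graph (n : ℕ) : Set where
  field
    adj    : Fin n → Fin n → Bool
    sym    : ∀ i j → adj i j ≡ adj j i
    irrefl : ∀ i → adj i i ≡ false
open Graph public

sumFin : ∀ {n} → (Fin n → ℕ) → ℕ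
sumFin {zero}  f = 0
sumFin {suc n} f = f zero + sumFin (λ i → f (suc i))

count : ∀ {n} → (Fin n → Bool) → ℕ
count p = sumFin (λ i → if p i then 1 else 0)

VSet : ℕ → Set
VSet n = Fin n → Bool

-- edge sets as Boolean relations (used symmetrically)
ESet : ℕ → Set
ESet n = Fin n → Fin n → Bool

-- number of (unordered) edges of a symmetric edge set: pairs i < j in it
edgeCount : ∀ {n} → ESet n → ℕ
edgeCount F = sumFin (λ i → count (λ j → F i j ∧ ⌊ toℕ i <? toℕ j ⌋))

IsIndependent : ∀ {n} → Graph n → VSet n → Set
IsIndependent G S = ∀ i j → S i ≡ true → S j ≡ true → adj G i j ≡ false

IsMatching : ∀ {n} → Graph n → ESet n → Set
IsMatching G F =
  (∀ i j → F i j ≡ true → adj G i j ≡ true) ×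
  (∀ i j → F i j ≡ F j i) ×
  (∀ i j k → F i j ≡ true → F i k ≡ true → j ≡ k)

IsPerfectMatching : ∀ {n} → Graph n → ESet n → Set
IsPerfectMatching G F = IsMatching G F × (∀ i → ∃[ j ] F i j ≡ true)

IsAlpha : ∀ {n} → Graph n → ℕ → Set
IsAlpha G a = (∃[ S ] (IsIndependent G S × count S ≡ a)) ×
              (∀ S → IsIndependent G S → count S ≤ a)

IsMu : ∀ {n} → Graph n → ℕ → Set
IsMu G m = (∃[ F ] (IsMatching G F × edgeCount F ≡ m)) ×
           (∀ F → IsMatching G F → edgeCount F ≤ m)

IsKE : ∀ {n} → Graph n → Set
IsKE {n} G = ∃[ a ] ∃[ m ] (IsAlpha G a × IsMu G m × a + m ≡ n)

HasUniquePM : ∀ {n} → Graph n → Set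
HasUniquePM G = ∃[ F ] (IsPerfectMatching G F ×
                  (∀ F' → IsPerfectMatching G F' → ∀ i j → F' i j ≡ F i j))

IsLeaf : ∀ {n} → Graph n → VSet n → Fin n → Set
IsLeaf G S w = S w ≡ true × count (λ v → S v ∧ adj G w v) ≡ 1

remove2 : ∀ {n} → VSet n → Fin n → Fin n → VSet n
remove2 S w u v = S v ∧ not ⌊ v ≟ w ⌋ ∧ not ⌊ v ≟ u ⌋

-- LeafRemoval G S M R : some run of the (nondeterministic) procedure started
-- on G[S] outputs the edge list M and stops with remaining vertex set R.
data LeafRemoval {n} (G : Graph n) : VSet n → List (Fin n × Fin n) → VSet n → Set where
  stop : ∀ {S} → (∀ w → ¬ IsLeaf G S w) → LeafRemoval G S [] S
  step : ∀ {S M R} (w u : Fin n) → IsLeaf G S w → S u ≡ true → adj G w u ≡ true →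
         LeafRemoval G (remove2 S w u) M R →
         LeafRemoval G S ((w , u) ∷ M) R

fullSet : ∀ {n} → VSet n
fullSet _ = true

IsEmptySet : ∀ {n} → VSet n → Set
IsEmptySet R = ∀ v → R v ≡ false

InOutput : ∀ {n} → List (Fin n × Fin n) → Fin n → Fin n → Set
InOutput M i j = ((i , j) ∈ M) ⊎ ((j , i) ∈ M)

-- If the procedure empties G, the removed leaves form an independent set and the chosen
-- edges a perfect matching, both of size n/2.  Since |I| + |F| ≤ n for every independent
-- set I and matching F (each edge of F has an endpoint outside I), α = μ = n/2.  Every
-- perfect matching must match each removed leaf to its unique remaining neighbour, so it
-- coincides with the output.
--
-- Conversely, let G be König–Egerváry with unique perfect matching F₀.  A perfect matching
-- is maximum, so α + |F₀| = n, and a maximum independent set I then meets every edge of F₀.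
-- The procedure only removes edges of F₀, so what remains is a leafless set R closed under
-- F₀.  From a vertex of R ∩ I, step to a neighbour in R other than its F₀-partner (it lies
-- outside I) and then to that neighbour's F₀-partner (back in R ∩ I); iterating returns to
-- a vertex already visited, and switching F₀ along that alternating cycle gives a second
-- perfect matching.  Hence R is empty.

module Submission where

open import Defs renaming (sym to adj-sym)
open import Data.Nat using (ℕ; zero; suc; NonZero; _+_; _*_; _∸_; _≤_; _<_; z≤n; s≤s; _<?_)
open import Data.Nat.Properties hiding (_≟_)
open import Data.Nat.DivMod using (_%_; _/_; m≡m%n+[m/n]*n; m%n<n)
open import Data.Nat.GeneralisedArithmetic using (fold; fold-+)
open import Data.Nat.Tactic.RingSolver using (solve-∀)
open import Data.Fin using (Fin; zero; suc; toℕ; fromℕ<; _≟_)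
open import Data.Fin.Properties using (toℕ-injective; toℕ-fromℕ<; any?; pigeonhole)
  renaming (suc-injective to Fin-suc-injective)
open import Data.Bool using (Bool; true; false; _∧_; _∨_; not; if_then_else_)
open import Data.Bool.Properties using (T-≡; ∧-assoc; ∧-zeroʳ; ∧-identityʳ; ∨-zeroʳ; ∨-identityʳ) renaming (_≟_ to _≟ᵇ_)
open import Data.List using (List; []; _∷_; length)
open import Data.List.Relation.Unary.Any using (here; there)
open import Data.Product using (_×_; _,_; ∃; ∃-syntax; proj₁; proj₂; map₁; map₂)
open import Data.Product.Properties using (≡-dec)
open import Data.Sum using (_⊎_; inj₁; inj₂)
open import Data.Empty using (⊥; ⊥-elim)
open import Function.Base using (_∘_)
open import Function.Bundles using (_⇔_; mk⇔; Equivalence)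
open import Relation.Nullary using (¬_; Dec; yes; no)
open import Relation.Nullary.Decidable
  using (⌊_⌋; toWitness; fromWitness; map′; ¬?; _×-dec_; _⊎-dec_)
open import Relation.Binary.Definitions using (tri<; tri≈; tri>)
open import Relation.Binary.PropositionalEquality

isYes⇔ : ∀ {P : Set} (d : Dec P) → ⌊ d ⌋ ≡ true ⇔ P
isYes⇔ d = mk⇔ (toWitness ∘ Equivalence.from T-≡) (Equivalence.to T-≡ ∘ fromWitness)

bool-ext : ∀ {x y : Bool} → (x ≡ true → y ≡ true) → (y ≡ true → x ≡ true) → x ≡ y
bool-ext {true}  f _ = sym (f refl)
bool-ext {false} {true}  _ g = g refl
bool-ext {false} {false} _ _ = refl

-- Counting over Fin

indicator : Bool → ℕ
indicator b = if b then 1 else 0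

sumFin-cong : ∀ {n} {f g : Fin n → ℕ} → (∀ i → f i ≡ g i) → sumFin f ≡ sumFin g
sumFin-cong {zero}  e = refl
sumFin-cong {suc n} e = cong₂ _+_ (e zero) (sumFin-cong (e ∘ suc))

sumFin-exchange : ∀ {n} (f g : Fin n → ℕ) (a : Fin n) → (∀ i → i ≢ a → f i ≡ g i) →
  sumFin f + g a ≡ sumFin g + f a
sumFin-exchange {suc n} f g zero e
  rewrite sumFin-cong {f = f ∘ suc} {g ∘ suc} (λ i → e (suc i) λ ())
  = swap (f zero) (g zero) (sumFin (g ∘ suc))
  where
  swap : ∀ x y t → x + t + y ≡ y + t + x
  swap = solve-∀
sumFin-exchange {suc n} f g (suc a) e rewrite e zero (λ ()) = begin
  g zero + sumFin (f ∘ suc) + g (suc a)    ≡⟨ +-assoc (g zero) _ _ ⟩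
  g zero + (sumFin (f ∘ suc) + g (suc a))  ≡⟨ cong (g zero +_) (sumFin-exchange (f ∘ suc) (g ∘ suc) a
                                                (λ i i≢a → e (suc i) (i≢a ∘ Fin-suc-injective))) ⟩
  g zero + (sumFin (g ∘ suc) + f (suc a))  ≡⟨ +-assoc (g zero) _ _ ⟨
  g zero + sumFin (g ∘ suc) + f (suc a)    ∎
  where open ≡-Reasoning

sumFin≡suc⇒∃ : ∀ {n} (f : Fin n → ℕ) {k} → sumFin f ≡ suc k → ∃[ i ] ∃[ k′ ] f i ≡ suc k′
sumFin≡suc⇒∃ {suc n} f e with f zero in f0
... | suc k′ = zero , k′ , f0
... | zero with sumFin≡suc⇒∃ (f ∘ suc) e
...   | i , k′ , fi = suc i , k′ , fi

∧-true⁻ : ∀ {x y} → x ∧ y ≡ true → x ≡ true × y ≡ true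
∧-true⁻ {true} y≡true = refl , y≡true

_∖_ : ∀ {n} → VSet n → Fin n → VSet n
(S ∖ a) v = S v ∧ not ⌊ v ≟ a ⌋

∖-≢ : ∀ {n} (S : VSet n) {a v} → v ≢ a → (S ∖ a) v ≡ S v
∖-≢ S {a} {v} v≢a with v ≟ a | S v
... | yes v≡a | _     = ⊥-elim (v≢a v≡a)
... | no _    | true  = refl
... | no _    | false = refl

∖-self : ∀ {n} (S : VSet n) a → (S ∖ a) a ≡ false
∖-self S a with a ≟ a | S a
... | no a≢a | _     = ⊥-elim (a≢a refl)
... | yes _  | true  = refl
... | yes _  | false = refl

_⊆_ : ∀ {n} → VSet n → VSet n → Set
I ⊆ S = ∀ i → I i ≡ true → S i ≡ true

count-cong : ∀ {n} {p q : VSet n} → (∀ i → p i ≡ q i) → count p ≡ count q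
count-cong e = sumFin-cong (cong indicator ∘ e)

count-∖ : ∀ {n} (q : VSet n) a → count q ≡ count (q ∖ a) + indicator (q a)
count-∖ q a = begin
  count q                                          ≡⟨ +-identityʳ _ ⟨
  count q + indicator false                        ≡⟨ cong (λ b → count q + indicator b) (∖-self q a) ⟨
  count q + indicator ((q ∖ a) a)                  ≡⟨ sumFin-exchange _ _ a (λ i i≢a → cong indicator (∖-≢ q i≢a)) ⟨
  count (q ∖ a) + indicator (q a)                  ∎
  where open ≡-Reasoning

count-empty : ∀ {n} (q : VSet n) → (∀ i → q i ≡ false) → count q ≡ 0
count-empty {zero}  q e = refl
count-empty {suc n} q e rewrite e zero = count-empty (q ∘ suc) (e ∘ suc)

count-full : ∀ {n} → count {n} fullSet ≡ n
count-full {zero}  = refl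
count-full {suc n} = cong suc (count-full {n})

count-mono : ∀ {n} (p q : VSet n) → p ⊆ q → count p ≤ count q
count-mono {zero}  p q p⊆q = z≤n
count-mono {suc n} p q p⊆q with p zero in p0 | q zero in q0
... | true  | true  = s≤s (count-mono (p ∘ suc) (q ∘ suc) (p⊆q ∘ suc))
... | true  | false with () ← trans (sym (p⊆q zero p0)) q0
... | false | true  = m≤n⇒m≤1+n (count-mono (p ∘ suc) (q ∘ suc) (p⊆q ∘ suc))
... | false | false = count-mono (p ∘ suc) (q ∘ suc) (p⊆q ∘ suc)

count≡suc⇒∃ : ∀ {n} (q : VSet n) {k} → count q ≡ suc k → ∃[ a ] q a ≡ true
count≡suc⇒∃ q e with sumFin≡suc⇒∃ (indicator ∘ q) e
... | a , _ , qa with q a in e′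
...   | true = a , e′

count-singleton : ∀ {n} (q : VSet n) b → (∀ x → q x ≡ true → x ≡ b) → count q ≡ indicator (q b)
count-singleton q b only-b = trans (count-∖ q b) (cong (_+ indicator (q b)) (count-empty (q ∖ b) outside))
  where
  outside : ∀ x → (q ∖ b) x ≡ false
  outside x with x ≟ b
  ... | yes refl = ∧-zeroʳ (q x)
  ... | no x≢b with q x in qx
  ...   | true  = ⊥-elim (x≢b (only-b x qx))
  ...   | false = refl

count-pos : ∀ {n} (q : VSet n) {a} → q a ≡ true → 1 ≤ count q
count-pos q {a} qa = subst (1 ≤_) (sym (count-∖ q a)) (subst (λ b → 1 ≤ count (q ∖ a) + indicator b) (sym qa) (m≤n+m 1 _))

count≡1-unique : ∀ {n} (q : VSet n) {a b} → count q ≡ 1 → q a ≡ true → q b ≡ true → a ≡ b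
count≡1-unique q {a} {b} c qa qb with a ≟ b
... | yes a≡b = a≡b
... | no a≢b = ⊥-elim (1+n≰n (begin
  2                                ≤⟨ +-monoˡ-≤ 1 (count-pos (q ∖ a) (trans (∖-≢ q (a≢b ∘ sym)) qb)) ⟩
  count (q ∖ a) + 1                ≡⟨ cong (λ x → count (q ∖ a) + indicator x) qa ⟨
  count (q ∖ a) + indicator (q a)  ≡⟨ count-∖ q a ⟨
  count q                          ≡⟨ c ⟩
  1                                ∎))
  where open ≤-Reasoning

remove2≗∖∖ : ∀ {n} (S : VSet n) a b v → remove2 S a b v ≡ ((S ∖ a) ∖ b) v
remove2≗∖∖ S a b v = sym (∧-assoc (S v) _ _)

remove2-true⁻ : ∀ {n} (S : VSet n) {a b v} → remove2 S a b v ≡ true → S v ≡ true × v ≢ a × v ≢ b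
remove2-true⁻ S {a} {b} {v} e with S v | v ≟ a | v ≟ b
... | true | no v≢a | no v≢b = refl , v≢a , v≢b
... | true | no _   | yes _  with () ← e
... | true | yes _  | _      with () ← e

remove2-true⁺ : ∀ {n} (S : VSet n) {a b v} → S v ≡ true → v ≢ a → v ≢ b → remove2 S a b v ≡ true
remove2-true⁺ S {a} {b} {v} Sv v≢a v≢b with S v | v ≟ a | v ≟ b
... | true | no _      | no _      = refl
... | _    | yes v≡a   | _         = ⊥-elim (v≢a v≡a)
... | _    | no _      | yes v≡b   = ⊥-elim (v≢b v≡b)

count-remove2 : ∀ {n} (S : VSet n) {a b} → a ≢ b →
  count S ≡ count (remove2 S a b) + indicator (S a) + indicator (S b)
count-remove2 S {a} {b} a≢b = begin
  count S                                                     ≡⟨ count-∖ S a ⟩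
  count (S ∖ a) + indicator (S a)                             ≡⟨ cong (_+ indicator (S a)) (count-∖ (S ∖ a) b) ⟩
  count ((S ∖ a) ∖ b) + indicator ((S ∖ a) b) + indicator (S a)
    ≡⟨ cong₂ (λ x y → x + indicator y + indicator (S a)) (count-cong (remove2≗∖∖ S a b)) (sym (∖-≢ S (a≢b ∘ sym))) ⟨
  count (remove2 S a b) + indicator (S b) + indicator (S a)   ≡⟨ swap-last (count (remove2 S a b)) _ _ ⟩
  count (remove2 S a b) + indicator (S a) + indicator (S b)   ∎
  where
  open ≡-Reasoning
  swap-last : ∀ x y z → x + y + z ≡ x + z + y
  swap-last = solve-∀

count-remove2-pair : ∀ {n} (S : VSet n) {a b} → a ≢ b → S a ≡ true → S b ≡ true →
  count S ≡ 2 + count (remove2 S a b)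
count-remove2-pair S {a} {b} a≢b Sa Sb = begin
  count S                                                     ≡⟨ count-remove2 S a≢b ⟩
  count (remove2 S a b) + indicator (S a) + indicator (S b)   ≡⟨ cong₂ (λ x y → count (remove2 S a b) + indicator x + indicator y) Sa Sb ⟩
  count (remove2 S a b) + 1 + 1                               ≡⟨ +-assoc (count (remove2 S a b)) 1 1 ⟩
  count (remove2 S a b) + 2                                   ≡⟨ +-comm (count (remove2 S a b)) 2 ⟩
  2 + count (remove2 S a b)                                   ∎
  where open ≡-Reasoning

insert : ∀ {n} → VSet n → Fin n → VSet n
insert S a v = S v ∨ ⌊ v ≟ a ⌋

insert-true⁻ : ∀ {n} (S : VSet n) {a v} → insert S a v ≡ true → S v ≡ true ⊎ v ≡ a
insert-true⁻ S {a} {v} e with S v | v ≟ a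
... | true  | _       = inj₁ refl
... | false | yes v≡a = inj₂ v≡a

count-insert : ∀ {n} (S : VSet n) {a} → S a ≡ false → count (insert S a) ≡ suc (count S)
count-insert S {a} Sa = begin
  count (insert S a)                                  ≡⟨ count-∖ (insert S a) a ⟩
  count (insert S a ∖ a) + indicator (insert S a a)   ≡⟨ cong₂ _+_ (count-cong removed) (cong indicator inserted) ⟩
  count S + 1                                         ≡⟨ +-comm (count S) 1 ⟩
  suc (count S)                                       ∎
  where
  open ≡-Reasoning
  removed : ∀ v → (insert S a ∖ a) v ≡ S v
  removed v with v ≟ a
  ... | yes refl = trans (∧-zeroʳ _) (sym Sa)
  ... | no _     = trans (∧-identityʳ _) (∨-identityʳ (S v))
  inserted : insert S a a ≡ true
  inserted = trans (cong (S a ∨_) (Equivalence.from (isYes⇔ (a ≟ a)) refl)) (∨-zeroʳ (S a))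

precedes : ∀ {n} → Fin n → Fin n → Bool
precedes i j = ⌊ toℕ i <? toℕ j ⌋

precedes-either : ∀ {n} {a b : Fin n} → a ≢ b → indicator (precedes b a) + indicator (precedes a b) ≡ 1
precedes-either {a = a} {b} a≢b with <-cmp (toℕ a) (toℕ b) | toℕ b <? toℕ a | toℕ a <? toℕ b
... | tri< _   _ _   | no _    | yes _   = refl
... | tri> _   _ _   | yes _   | no _    = refl
... | tri≈ _ a≡b _   | _       | _       = ⊥-elim (a≢b (toℕ-injective a≡b))
... | tri< a<b _ _   | yes b<a | _       = ⊥-elim (<-asym a<b b<a)
... | tri< a<b _ _   | no _    | no a≮b  = ⊥-elim (a≮b a<b)
... | tri> _   _ b<a | _       | yes a<b = ⊥-elim (<-asym a<b b<a)
... | tri> _   _ b<a | no b≮a  | no _    = ⊥-elim (b≮a b<a)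

rowCount : ∀ {n} → ESet n → Fin n → ℕ
rowCount F i = count (λ j → F i j ∧ precedes i j)

_⊖_ : ∀ {n} → ESet n → Fin n → ESet n
(F ⊖ a) i j = ((λ i′ → F i′ j) ∖ a) i

rowCount-⊖ : ∀ {n} (F : ESet n) {a i} → i ≢ a → rowCount (F ⊖ a) i ≡ rowCount F i
rowCount-⊖ F {i = i} i≢a = count-cong (λ j → cong (_∧ precedes i j) (∖-≢ (λ i′ → F i′ j) i≢a))

edgeCount-⊖ : ∀ {n} (F : ESet n) a → edgeCount F ≡ edgeCount (F ⊖ a) + rowCount F a
edgeCount-⊖ F a = begin
  edgeCount F                          ≡⟨ +-identityʳ _ ⟨
  edgeCount F + 0                      ≡⟨ cong (edgeCount F +_) cleared ⟨
  edgeCount F + rowCount (F ⊖ a) a     ≡⟨ sumFin-exchange (rowCount F) (rowCount (F ⊖ a)) a untouched ⟩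
  edgeCount (F ⊖ a) + rowCount F a     ∎
  where
  open ≡-Reasoning
  cleared : rowCount (F ⊖ a) a ≡ 0
  cleared = count-empty _ (λ j → cong (_∧ precedes a j) (∖-self (λ i′ → F i′ j) a))
  untouched : ∀ i → i ≢ a → rowCount F i ≡ rowCount (F ⊖ a) i
  untouched i i≢a = sym (rowCount-⊖ F i≢a)

rowCount-single : ∀ {n} (F : ESet n) {a b} → (∀ x → F a x ≡ true → x ≡ b) → F a b ≡ true →
  rowCount F a ≡ indicator (precedes a b)
rowCount-single F {a} {b} only-b Fab =
  trans (count-singleton _ b (λ x e → only-b x (proj₁ (∧-true⁻ e)))) (cong (λ z → indicator (z ∧ precedes a b)) Fab)

edgeCount≡suc⇒∃ : ∀ {n} (F : ESet n) {k} → edgeCount F ≡ suc k → ∃[ a ] ∃[ b ] F a b ≡ true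
edgeCount≡suc⇒∃ F e with sumFin≡suc⇒∃ (rowCount F) e
... | a , _ , row with count≡suc⇒∃ _ row
...   | b , Fab∧ with F a b in Fab
...     | true = a , b , Fab

peel : ∀ {n} → ESet n → Fin n → Fin n → ESet n
peel F a b i j = remove2 (λ i′ → F i′ j) a b i

peel-true⁻ : ∀ {n} (F : ESet n) {a b i j} → peel F a b i j ≡ true → F i j ≡ true × i ≢ a × i ≢ b
peel-true⁻ F {j = j} = remove2-true⁻ (λ i′ → F i′ j)

peel-true⁺ : ∀ {n} (F : ESet n) {a b i j} → F i j ≡ true → i ≢ a → i ≢ b → peel F a b i j ≡ true
peel-true⁺ F {j = j} = remove2-true⁺ (λ i′ → F i′ j)

remove2-mono : ∀ {n} {I S : VSet n} {a b} → I ⊆ S → remove2 I a b ⊆ remove2 S a b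
remove2-mono {I = I} {S} I⊆S v e with remove2-true⁻ I e
... | Iv , v≢a , v≢b = remove2-true⁺ S (I⊆S v Iv) v≢a v≢b

Saturates : ∀ {n} → VSet n → ESet n → Set
Saturates S F = ∀ i → S i ≡ true → ∃[ j ] F i j ≡ true

Closed : ∀ {n} → VSet n → ESet n → Set
Closed S F = ∀ i j → S i ≡ true → F i j ≡ true → S j ≡ true

InOutput? : ∀ {n} (M : List (Fin n × Fin n)) i j → Dec (InOutput M i j)
InOutput? M i j = ((i , j) ∈? M) ⊎-dec ((j , i) ∈? M)
  where open import Data.List.Membership.DecPropositional (≡-dec _≟_ _≟_) using (_∈?_)

output : ∀ {n} → List (Fin n × Fin n) → ESet n
output M i j = ⌊ InOutput? M i j ⌋

InOutput-swap : ∀ {n} {M : List (Fin n × Fin n)} {i j} → InOutput M i j → InOutput M j i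
InOutput-swap (inj₁ ij) = inj₂ ij
InOutput-swap (inj₂ ji) = inj₁ ji

InOutput-∷⁻ : ∀ {n} {w u : Fin n} {M i j} → InOutput ((w , u) ∷ M) i j →
  (i ≡ w × j ≡ u) ⊎ (i ≡ u × j ≡ w) ⊎ InOutput M i j
InOutput-∷⁻ (inj₁ (here refl))  = inj₁ (refl , refl)
InOutput-∷⁻ (inj₂ (here refl))  = inj₂ (inj₁ (refl , refl))
InOutput-∷⁻ (inj₁ (there ij))   = inj₂ (inj₂ (inj₁ ij))
InOutput-∷⁻ (inj₂ (there ji))   = inj₂ (inj₂ (inj₂ ji))

InOutput-∷⁺ : ∀ {n} {w u : Fin n} {M i j} → InOutput M i j → InOutput ((w , u) ∷ M) i j
InOutput-∷⁺ (inj₁ ij) = inj₁ (there ij)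
InOutput-∷⁺ (inj₂ ji) = inj₂ (there ji)

fold-suc′ : ∀ {A : Set} (f : A → A) x k → fold x f (suc k) ≡ fold (f x) f k
fold-suc′ f x zero    = refl
fold-suc′ f x (suc k) = cong f (fold-suc′ f x k)

fold-preserves : ∀ {A : Set} (P : A → Set) (f : A → A) → (∀ {x} → P x → P (f x)) → ∀ {x} k → P x → P (fold x f k)
fold-preserves P f preserves zero    Px = Px
fold-preserves P f preserves (suc k) Px = preserves (fold-preserves P f preserves k Px)

module _ {A : Set} (f : A → A) {x : A} (d : ℕ) .{{_ : NonZero d}} (x-periodic : fold x f d ≡ x) where

  fold-multiple : ∀ q → fold x f (q * d) ≡ x
  fold-multiple zero    = refl
  fold-multiple (suc q) = begin
    fold x f (d + q * d)          ≡⟨ fold-+ x f d ⟩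
    fold (fold x f (q * d)) f d   ≡⟨ cong (λ z → fold z f d) (fold-multiple q) ⟩
    fold x f d                    ≡⟨ x-periodic ⟩
    x                             ∎
    where open ≡-Reasoning

  fold-mod : ∀ k → fold x f k ≡ fold x f (k % d)
  fold-mod k = begin
    fold x f k                              ≡⟨ cong (fold x f) (m≡m%n+[m/n]*n k d) ⟩
    fold x f (k % d + (k / d) * d)          ≡⟨ fold-+ x f (k % d) ⟩
    fold (fold x f ((k / d) * d)) f (k % d) ≡⟨ cong (λ z → fold z f (k % d)) (fold-multiple (k / d)) ⟩
    fold x f (k % d)                        ∎
    where open ≡-Reasoning

module _ {n} (G : Graph n) where

  -- Matchings and independent sets

  adj⇒≢ : ∀ {a b} → adj G a b ≡ true → a ≢ b
  adj⇒≢ {a} e refl with () ← trans (sym e) (irrefl G a)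

  MatchingOn : VSet n → ESet n → Set
  MatchingOn S F = IsMatching G F × (∀ i j → F i j ≡ true → S i ≡ true)

  module _ {F : ESet n} (F-matching : IsMatching G F) {a b : Fin n} (Fab : F a b ≡ true) where

    private
      F-sym = proj₁ (proj₂ F-matching)
      F-functional = proj₂ (proj₂ F-matching)

    matched-≢ : a ≢ b
    matched-≢ = adj⇒≢ (proj₁ F-matching a b Fab)

    partners-avoid : ∀ {i j} → F i j ≡ true → i ≢ a → i ≢ b → j ≢ a × j ≢ b
    partners-avoid {i} Fij i≢a i≢b =
      (λ { refl → i≢b (F-functional a i b (trans (F-sym a i) Fij) Fab) }) ,
      (λ { refl → i≢a (F-functional b i a (trans (F-sym b i) Fij) (trans (F-sym b a) Fab)) })

    peel-matching : IsMatching G (peel F a b)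
    peel-matching = (λ i j e → proj₁ F-matching i j (proj₁ (peel-true⁻ F e))) ,
                    (λ i j → bool-ext (flip i j) (flip j i)) ,
                    (λ i j k e e′ → F-functional i j k (proj₁ (peel-true⁻ F e)) (proj₁ (peel-true⁻ F e′)))
      where
      flip : ∀ i j → peel F a b i j ≡ true → peel F a b j i ≡ true
      flip i j e with peel-true⁻ F e
      ... | Fij , i≢a , i≢b with partners-avoid Fij i≢a i≢b
      ...   | j≢a , j≢b = peel-true⁺ F (trans (F-sym j i) Fij) j≢a j≢b

    edgeCount-peel : edgeCount F ≡ suc (edgeCount (peel F a b))
    edgeCount-peel = begin
      edgeCount F                                                  ≡⟨ edgeCount-⊖ F a ⟩
      edgeCount (F ⊖ a) + rowCount F a                             ≡⟨ cong (_+ rowCount F a) (edgeCount-⊖ (F ⊖ a) b) ⟩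
      edgeCount ((F ⊖ a) ⊖ b) + rowCount (F ⊖ a) b + rowCount F a
        ≡⟨ cong₂ (λ x y → x + y + rowCount F a) peeled (sym (rowCount-⊖ F (matched-≢ ∘ sym))) ⟨
      edgeCount (peel F a b) + rowCount F b + rowCount F a
        ≡⟨ cong₂ (λ x y → edgeCount (peel F a b) + x + y) (rowCount-single F (only b a (trans (F-sym b a) Fab)) (trans (F-sym b a) Fab))
                                                          (rowCount-single F (only a b Fab) Fab) ⟩
      edgeCount (peel F a b) + indicator (precedes b a) + indicator (precedes a b)
        ≡⟨ +-assoc (edgeCount (peel F a b)) _ _ ⟩
      edgeCount (peel F a b) + (indicator (precedes b a) + indicator (precedes a b))
        ≡⟨ cong (edgeCount (peel F a b) +_) (precedes-either matched-≢) ⟩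
      edgeCount (peel F a b) + 1                                   ≡⟨ +-comm _ 1 ⟩
      suc (edgeCount (peel F a b))                                 ∎
      where
      open ≡-Reasoning
      peeled : edgeCount (peel F a b) ≡ edgeCount ((F ⊖ a) ⊖ b)
      peeled = sumFin-cong (λ i → count-cong (λ j → cong (_∧ precedes i j) (remove2≗∖∖ (λ i′ → F i′ j) a b i)))
      only : ∀ x y → F x y ≡ true → ∀ z → F x z ≡ true → z ≡ y
      only x y Fxy z Fxz = F-functional x z y Fxz Fxy

  peel-matchingOn : ∀ {S F a b} → MatchingOn S F → F a b ≡ true → MatchingOn (remove2 S a b) (peel F a b)
  peel-matchingOn {S} {F} (F-matching , F⊆S) Fab = peel-matching F-matching Fab , within
    where
    within : ∀ i j → peel F _ _ i j ≡ true → remove2 S _ _ i ≡ true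
    within i j e with peel-true⁻ F e
    ... | Fij , i≢a , i≢b = remove2-true⁺ S (F⊆S i j Fij) i≢a i≢b

  count-matched : ∀ {S F a b} → MatchingOn S F → F a b ≡ true → count S ≡ 2 + count (remove2 S a b)
  count-matched {S} {F} {a} {b} (F-matching , F⊆S) Fab =
    count-remove2-pair S (matched-≢ F-matching Fab) (F⊆S a b Fab) (F⊆S b a (trans (proj₁ (proj₂ F-matching) b a) Fab))

  matching-ind : (P : VSet n → ESet n → ℕ → Set) →
    (∀ {S F} → MatchingOn S F → edgeCount F ≡ 0 → P S F 0) →
    (∀ {S F a b k} → MatchingOn S F → F a b ≡ true → P (remove2 S a b) (peel F a b) k → P S F (suc k)) →
    ∀ {S F} → MatchingOn S F → P S F (edgeCount F)
  matching-ind P edgeless peel-step m = go _ m refl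
    where
    go : ∀ k {S F} → MatchingOn S F → edgeCount F ≡ k → P S F k
    go zero    m e = edgeless m e
    go (suc k) {F = F} m e with edgeCount≡suc⇒∃ F e
    ... | a , b , Fab = peel-step m Fab (go k (peel-matchingOn m Fab) (suc-injective (trans (sym (edgeCount-peel (proj₁ m) Fab)) e)))

  independent-pair : ∀ {I a b} → IsIndependent G I → adj G a b ≡ true → indicator (I a) + indicator (I b) ≤ 1
  independent-pair {I} {a} {b} I-indep adj-ab with I a in Ia | I b in Ib
  ... | true  | true  with () ← trans (sym (I-indep a b Ia Ib)) adj-ab
  ... | true  | false = ≤-refl
  ... | false | true  = ≤-refl
  ... | false | false = z≤n

  count-independent-remove2 : ∀ {I a b} → IsIndependent G I → adj G a b ≡ true → count I ≤ count (remove2 I a b) + 1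
  count-independent-remove2 {I} {a} {b} I-indep adj-ab = begin
    count I                                                      ≡⟨ count-remove2 I (adj⇒≢ adj-ab) ⟩
    count (remove2 I a b) + indicator (I a) + indicator (I b)    ≡⟨ +-assoc (count (remove2 I a b)) _ _ ⟩
    count (remove2 I a b) + (indicator (I a) + indicator (I b))  ≤⟨ +-monoʳ-≤ (count (remove2 I a b)) (independent-pair I-indep adj-ab) ⟩
    count (remove2 I a b) + 1                                    ∎
    where open ≤-Reasoning

  remove2-independent : ∀ {I a b} → IsIndependent G I → IsIndependent G (remove2 I a b)
  remove2-independent {I} I-indep i j Ii Ij = I-indep i j (proj₁ (remove2-true⁻ I Ii)) (proj₁ (remove2-true⁻ I Ij))

  independent+matching≤ : ∀ {S F I} → MatchingOn S F → I ⊆ S → IsIndependent G I → count I + edgeCount F ≤ count S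
  independent+matching≤ m = matching-ind P edgeless peel-step m
    where
    P : VSet n → ESet n → ℕ → Set
    P S F k = ∀ {I} → I ⊆ S → IsIndependent G I → count I + k ≤ count S
    edgeless : ∀ {S F} → MatchingOn S F → edgeCount F ≡ 0 → P S F 0
    edgeless {S} _ _ {I} I⊆S _ = subst (_≤ count S) (sym (+-identityʳ (count I))) (count-mono I S I⊆S)
    peel-step : ∀ {S F a b k} → MatchingOn S F → F a b ≡ true → P (remove2 S a b) (peel F a b) k → P S F (suc k)
    peel-step {S} {F} {a} {b} {k} m Fab ih {I} I⊆S I-indep = begin
      count I + suc k                     ≤⟨ +-monoˡ-≤ (suc k) (count-independent-remove2 I-indep (proj₁ (proj₁ m) a b Fab)) ⟩
      count (remove2 I a b) + 1 + suc k   ≡⟨ shuffle (count (remove2 I a b)) k ⟩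
      2 + (count (remove2 I a b) + k)     ≤⟨ +-monoʳ-≤ 2 (ih (remove2-mono I⊆S) (remove2-independent I-indep)) ⟩
      2 + count (remove2 S a b)           ≡⟨ count-matched m Fab ⟨
      count S                             ∎
      where
      open ≤-Reasoning
      shuffle : ∀ x k → x + 1 + suc k ≡ 2 + (x + k)
      shuffle = solve-∀

  uncovered⇒independent+matching< : ∀ {S F I a b} → MatchingOn S F → I ⊆ S → IsIndependent G I →
    F a b ≡ true → I a ≡ false → I b ≡ false → count I + edgeCount F < count S
  uncovered⇒independent+matching< {S} {F} {I} {a} {b} m I⊆S I-indep Fab Ia Ib = begin-strict
    count I + edgeCount F                                 ≡⟨ cong₂ _+_ count-I (edgeCount-peel (proj₁ m) Fab) ⟩
    count (remove2 I a b) + suc (edgeCount (peel F a b))  ≡⟨ +-suc _ _ ⟩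
    suc (count (remove2 I a b) + edgeCount (peel F a b))  <⟨ n<1+n _ ⟩
    2 + (count (remove2 I a b) + edgeCount (peel F a b))  ≤⟨ +-monoʳ-≤ 2 peeled-bound ⟩
    2 + count (remove2 S a b)                             ≡⟨ count-matched m Fab ⟨
    count S                                               ∎
    where
    open ≤-Reasoning
    peeled-bound = independent+matching≤ (peel-matchingOn m Fab) (remove2-mono I⊆S) (remove2-independent I-indep)
    count-I : count I ≡ count (remove2 I a b)
    count-I = begin-equality
      count I                                                    ≡⟨ count-remove2 I (matched-≢ (proj₁ m) Fab) ⟩
      count (remove2 I a b) + indicator (I a) + indicator (I b)  ≡⟨ cong₂ (λ x y → count (remove2 I a b) + indicator x + indicator y) Ia Ib ⟩
      count (remove2 I a b) + 0 + 0                              ≡⟨ cong (_+ 0) (+-identityʳ _) ⟩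
      count (remove2 I a b) + 0                                  ≡⟨ +-identityʳ _ ⟩
      count (remove2 I a b)                                      ∎

  2*matching≤ : ∀ {S F} → MatchingOn S F → 2 * edgeCount F ≤ count S
  2*matching≤ = matching-ind (λ S _ k → 2 * k ≤ count S) (λ _ _ → z≤n) peel-step
    where
    peel-step : ∀ {S F a b k} → MatchingOn S F → F a b ≡ true → 2 * k ≤ count (remove2 S a b) → 2 * suc k ≤ count S
    peel-step {S} {k = k} m Fab ih = subst₂ _≤_ (sym (*-suc 2 k)) (sym (count-matched m Fab)) (+-monoʳ-≤ 2 ih)

  saturating⇒count≡2*matching : ∀ {S F} → MatchingOn S F → Saturates S F → count S ≡ 2 * edgeCount F
  saturating⇒count≡2*matching m = matching-ind P edgeless peel-step m
    where
    P : VSet n → ESet n → ℕ → Set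
    P S F k = Saturates S F → count S ≡ 2 * k
    edgeless : ∀ {S F} → MatchingOn S F → edgeCount F ≡ 0 → P S F 0
    edgeless {S} {F} m no-edges sat = count-empty S empty
      where
      empty : ∀ i → S i ≡ false
      empty i with S i in Si
      ... | false = refl
      ... | true with sat i Si
      ...   | j , Fij with () ← trans (sym no-edges) (edgeCount-peel (proj₁ m) Fij)
    peel-step : ∀ {S F a b k} → MatchingOn S F → F a b ≡ true → P (remove2 S a b) (peel F a b) k → P S F (suc k)
    peel-step {S} {F} {a} {b} {k} m Fab ih sat = begin
      count S                    ≡⟨ count-matched m Fab ⟩
      2 + count (remove2 S a b)  ≡⟨ cong (2 +_) (ih sat′) ⟩
      2 + 2 * k                  ≡⟨ *-suc 2 k ⟨
      2 * suc k                  ∎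
      where
      open ≡-Reasoning
      sat′ : Saturates (remove2 S a b) (peel F a b)
      sat′ i e with remove2-true⁻ S e
      ... | Si , i≢a , i≢b with sat i Si
      ...   | j , Fij = j , peel-true⁺ F Fij i≢a i≢b

  -- Runs of the leaf-removal procedure

  leaf-neighbour-unique : ∀ {S w u v} → IsLeaf G S w → S u ≡ true → adj G w u ≡ true →
    S v ≡ true → adj G w v ≡ true → v ≡ u
  leaf-neighbour-unique (_ , degree-1) Su wu Sv wv = count≡1-unique _ degree-1 (cong₂ _∧_ Sv wv) (cong₂ _∧_ Su wu)

  non-leaf⇒other-neighbour : ∀ {S v x} → ¬ IsLeaf G S v → S v ≡ true → S x ≡ true → adj G v x ≡ true →
    ¬ (∀ t → (S t ∧ adj G v t) ≡ true → t ≡ x)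
  non-leaf⇒other-neighbour not-leaf Sv Sx vx only-x =
    not-leaf (Sv , trans (count-singleton _ _ only-x) (cong indicator (cong₂ _∧_ Sx vx)))

  insert-independent : ∀ {I a} → IsIndependent G I → (∀ j → I j ≡ true → adj G a j ≡ false) →
    IsIndependent G (insert I a)
  insert-independent {I} {a} I-indep a-isolated i j Ii Ij with insert-true⁻ I Ii | insert-true⁻ I Ij
  ... | inj₁ Ii′   | inj₁ Ij′   = I-indep i j Ii′ Ij′
  ... | inj₂ refl  | inj₁ Ij′   = a-isolated j Ij′
  ... | inj₁ Ii′   | inj₂ refl  = trans (adj-sym G i a) (a-isolated i Ii′)
  ... | inj₂ refl  | inj₂ refl  = irrefl G i

  leaf-matched : ∀ {S F w u} → IsPerfectMatching G F → Closed S F →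
    IsLeaf G S w → S u ≡ true → adj G w u ≡ true → F w u ≡ true
  leaf-matched {S} {F} {w} {u} ((F⊆adj , _) , F-saturates) S-closed w-leaf Su wu with F-saturates w
  ... | p , Fwp with leaf-neighbour-unique w-leaf Su wu (S-closed w p (proj₁ w-leaf) Fwp) (F⊆adj w p Fwp)
  ...   | refl = Fwp

  closed-remove2 : ∀ {S F a b} → IsMatching G F → Closed S F → F a b ≡ true → Closed (remove2 S a b) F
  closed-remove2 {S} F-matching S-closed Fab i j e Fij with remove2-true⁻ S e
  ... | Si , i≢a , i≢b with partners-avoid F-matching Fab Fij i≢a i≢b
  ...   | j≢a , j≢b = remove2-true⁺ S (S-closed i j Si Fij) j≢a j≢b

  run-stuck : ∀ {S M R} → LeafRemoval G S M R → ∀ w → ¬ IsLeaf G R w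
  run-stuck (stop no-leaf)        = no-leaf
  run-stuck (step _ _ _ _ _ run)  = run-stuck run

  run-count : ∀ {S M R} → LeafRemoval G S M R → IsEmptySet R → count S ≡ 2 * length M
  run-count (stop _) R-empty = count-empty _ R-empty
  run-count {S} (step {M = M} w u (Sw , _) Su wu run) R-empty = begin
    count S                    ≡⟨ count-remove2-pair S (adj⇒≢ wu) Sw Su ⟩
    2 + count (remove2 S w u)  ≡⟨ cong (2 +_) (run-count run R-empty) ⟩
    2 + 2 * length M           ≡⟨ *-suc 2 (length M) ⟨
    2 * suc (length M)         ∎
    where open ≡-Reasoning

  run-leaves : ∀ {S M R} → LeafRemoval G S M R → ∃[ L ] (L ⊆ S × IsIndependent G L × count L ≡ length M)
  run-leaves (stop _) = (λ _ → false) , (λ _ ()) , (λ _ _ ()) , count-empty {n} _ (λ _ → refl)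
  run-leaves {S} (step {M = M} w u w-leaf Su wu run) with run-leaves run
  ... | L , L⊆S′ , L-indep , L-count = insert L w , L⊆S , insert-independent L-indep w-isolated , L-count′
    where
    w∉L : L w ≡ false
    w∉L with L w in Lw
    ... | false = refl
    ... | true  = ⊥-elim (proj₁ (proj₂ (remove2-true⁻ S (L⊆S′ w Lw))) refl)
    L⊆S : insert L w ⊆ S
    L⊆S v e with insert-true⁻ L e
    ... | inj₁ Lv   = proj₁ (remove2-true⁻ S (L⊆S′ v Lv))
    ... | inj₂ refl = proj₁ w-leaf
    w-isolated : ∀ j → L j ≡ true → adj G w j ≡ false
    w-isolated j Lj with adj G w j in wj | remove2-true⁻ S (L⊆S′ j Lj)
    ... | false | _              = refl
    ... | true  | Sj , _ , j≢u   = ⊥-elim (j≢u (leaf-neighbour-unique w-leaf Su wu Sj wj))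
    L-count′ : count (insert L w) ≡ suc (length M)
    L-count′ = trans (count-insert L w∉L) (cong suc L-count)

  run-output-within : ∀ {S M R} → LeafRemoval G S M R → ∀ {i j} → InOutput M i j → S i ≡ true × adj G i j ≡ true
  run-output-within (stop _) (inj₁ ())
  run-output-within (stop _) (inj₂ ())
  run-output-within {S} (step w u (Sw , _) Su wu run) o with InOutput-∷⁻ o
  ... | inj₁ (refl , refl)        = Sw , wu
  ... | inj₂ (inj₁ (refl , refl)) = Su , trans (adj-sym G u w) wu
  ... | inj₂ (inj₂ o′)            = map₁ (proj₁ ∘ remove2-true⁻ S) (run-output-within run o′)

  run-output-avoids : ∀ S {w u M R i j} → LeafRemoval G (remove2 S w u) M R → InOutput M i j → i ≢ w × i ≢ u
  run-output-avoids S run o = proj₂ (remove2-true⁻ S (proj₁ (run-output-within run o)))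

  run-output-functional : ∀ {S M R} → LeafRemoval G S M R → ∀ {i j k} → InOutput M i j → InOutput M i k → j ≡ k
  run-output-functional (stop _) (inj₁ ()) _
  run-output-functional (stop _) (inj₂ ()) _
  run-output-functional {S} (step w u _ _ wu run) {i} o o′ with InOutput-∷⁻ o | InOutput-∷⁻ o′
  ... | inj₁ (_ , refl)        | inj₁ (_ , refl)        = refl
  ... | inj₂ (inj₁ (_ , refl)) | inj₂ (inj₁ (_ , refl)) = refl
  ... | inj₂ (inj₂ r)          | inj₂ (inj₂ r′)         = run-output-functional run r r′
  ... | inj₁ (refl , _)        | inj₂ (inj₁ (w≡u , _))  = ⊥-elim (adj⇒≢ wu w≡u)
  ... | inj₂ (inj₁ (refl , _)) | inj₁ (u≡w , _)        = ⊥-elim (adj⇒≢ wu (sym u≡w))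
  ... | inj₁ (refl , _)        | inj₂ (inj₂ r)          = ⊥-elim (proj₁ (run-output-avoids S run r) refl)
  ... | inj₂ (inj₂ r)          | inj₁ (refl , _)        = ⊥-elim (proj₁ (run-output-avoids S run r) refl)
  ... | inj₂ (inj₁ (refl , _)) | inj₂ (inj₂ r)          = ⊥-elim (proj₂ (run-output-avoids S run r) refl)
  ... | inj₂ (inj₂ r)          | inj₂ (inj₁ (refl , _)) = ⊥-elim (proj₂ (run-output-avoids S run r) refl)

  run-output-saturates : ∀ {S M R} → LeafRemoval G S M R → IsEmptySet R →
    ∀ v → S v ≡ true → ∃[ j ] InOutput M v j
  run-output-saturates (stop _) R-empty v Rv with () ← trans (sym Rv) (R-empty v)
  run-output-saturates {S} (step w u _ _ _ run) R-empty v Sv with v ≟ w | v ≟ u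
  ... | yes refl | _        = u , inj₁ (here refl)
  ... | no _     | yes refl = w , inj₂ (here refl)
  ... | no v≢w   | no v≢u   = map₂ InOutput-∷⁺ (run-output-saturates run R-empty v (remove2-true⁺ S Sv v≢w v≢u))

  run-output⊆ : ∀ {S M R F} → LeafRemoval G S M R → IsPerfectMatching G F → Closed S F →
    ∀ {i j} → InOutput M i j → F i j ≡ true
  run-output⊆ (stop _) _ _ (inj₁ ())
  run-output⊆ (stop _) _ _ (inj₂ ())
  run-output⊆ (step w u w-leaf Su wu run) F-perfect@(F-matching , _) S-closed o
    with leaf-matched F-perfect S-closed w-leaf Su wu | InOutput-∷⁻ o
  ... | Fwu | inj₁ (refl , refl)        = Fwu
  ... | Fwu | inj₂ (inj₁ (refl , refl)) = trans (proj₁ (proj₂ F-matching) u w) Fwu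
  ... | Fwu | inj₂ (inj₂ o′)            = run-output⊆ run F-perfect (closed-remove2 F-matching S-closed Fwu) o′

  run-closed : ∀ {S M R F} → LeafRemoval G S M R → IsPerfectMatching G F → Closed S F → Closed R F
  run-closed (stop _) _ S-closed = S-closed
  run-closed (step w u w-leaf Su wu run) F-perfect@(F-matching , _) S-closed =
    run-closed run F-perfect (closed-remove2 F-matching S-closed (leaf-matched F-perfect S-closed w-leaf Su wu))

  emptied⇒perfect-matching≡output : ∀ {S M R F} → LeafRemoval G S M R → IsEmptySet R →
    IsPerfectMatching G F → Closed S F → ∀ {i j} → S i ≡ true → F i j ≡ true ⇔ InOutput M i j
  emptied⇒perfect-matching≡output {F = F} run R-empty F-perfect@((_ , _ , F-functional) , _) S-closed {i} {j} Si =
    mk⇔ to (run-output⊆ run F-perfect S-closed)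
    where
    to : F i j ≡ true → InOutput _ i j
    to Fij with run-output-saturates run R-empty i Si
    ... | k , o = subst (InOutput _ i) (F-functional i k j (run-output⊆ run F-perfect S-closed o) Fij) o

  emptied⇒output-perfect : ∀ {S M R} → LeafRemoval G S M R → IsEmptySet R →
    MatchingOn S (output M) × Saturates S (output M)
  emptied⇒output-perfect {S} {M} run R-empty =
    (((λ i j → proj₂ ∘ run-output-within run ∘ to) ,
      (λ i j → bool-ext (from ∘ InOutput-swap ∘ to) (from ∘ InOutput-swap ∘ to)) ,
      (λ i j k e e′ → run-output-functional run (to e) (to e′))) ,
     (λ i j e → proj₁ (run-output-within run (to e)))) ,
    (λ i Si → map₂ from (run-output-saturates run R-empty i Si))
    where
    to : ∀ {i j} → output M i j ≡ true → InOutput M i j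
    to = Equivalence.to (isYes⇔ _)
    from : ∀ {i j} → InOutput M i j → output M i j ≡ true
    from = Equivalence.from (isYes⇔ _)

  -- König–Egerváry graphs with a unique perfect matching

  matchingOn-full : ∀ {F} → IsMatching G F → MatchingOn fullSet F
  matchingOn-full F-matching = F-matching , λ _ _ _ → refl

  perfect-matching-size : ∀ {F} → IsPerfectMatching G F → n ≡ 2 * edgeCount F
  perfect-matching-size (F-matching , F-saturates) =
    trans (sym count-full) (saturating⇒count≡2*matching (matchingOn-full F-matching) (λ i _ → F-saturates i))

  KE⇒independent-cover : ∀ {F} → IsKE G → IsPerfectMatching G F →
    ∃[ I ] (IsIndependent G I × (∀ a b → F a b ≡ true → I a ≡ true ⊎ I b ≡ true))
  KE⇒independent-cover {F} (α , μ , ((I , I-indep , I-size) , _) , ((F₁ , F₁-matching , F₁-size) , μ-maximum) , α+μ≡n)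
                       F-perfect@(F-matching , _) = I , I-indep , covered
    where
    2μ≤2e : 2 * μ ≤ 2 * edgeCount F
    2μ≤2e = subst₂ (λ x y → 2 * x ≤ y) F₁-size (trans count-full (perfect-matching-size F-perfect))
                   (2*matching≤ (matchingOn-full F₁-matching))
    e≡μ : edgeCount F ≡ μ
    e≡μ = ≤-antisym (μ-maximum F F-matching) (*-cancelˡ-≤ 2 2μ≤2e)
    covered : ∀ a b → F a b ≡ true → I a ≡ true ⊎ I b ≡ true
    covered a b Fab with I a in Ia | I b in Ib
    ... | true  | _     = inj₁ refl
    ... | false | true  = inj₂ refl
    ... | false | false = ⊥-elim (<-irrefl α+μ≡n (subst₂ _<_ (cong₂ _+_ I-size e≡μ) count-full
            (uncovered⇒independent+matching< (matchingOn-full F-matching) (λ _ _ → refl) I-indep Fab Ia Ib)))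

  module AlternatingCycle
    (I : VSet n) (F₀ : ESet n) (R : VSet n)
    (I-independent : IsIndependent G I)
    (F₀-perfect : IsPerfectMatching G F₀)
    (F₀-unique : ∀ F → IsPerfectMatching G F → ∀ i j → F i j ≡ F₀ i j)
    (F₀-covered : ∀ a b → F₀ a b ≡ true → I a ≡ true ⊎ I b ≡ true)
    (R-closed : Closed R F₀)
    (R-stuck : ∀ w → ¬ IsLeaf G R w)
    where

    private
      F₀-adj        = proj₁ (proj₁ F₀-perfect)
      F₀-sym        = proj₁ (proj₂ (proj₁ F₀-perfect))
      F₀-functional = proj₂ (proj₂ (proj₁ F₀-perfect))

    partner : Fin n → Fin n
    partner v = proj₁ (proj₂ F₀-perfect v)

    partner-F₀ : ∀ v → F₀ v (partner v) ≡ true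
    partner-F₀ v = proj₂ (proj₂ F₀-perfect v)

    partner-unique : ∀ {v j} → F₀ v j ≡ true → j ≡ partner v
    partner-unique {v} {j} F₀vj = F₀-functional v j (partner v) F₀vj (partner-F₀ v)

    partner-involutive : ∀ v → partner (partner v) ≡ v
    partner-involutive v = sym (partner-unique (trans (F₀-sym (partner v) v) (partner-F₀ v)))

    Core : Fin n → Set
    Core v = R v ≡ true × I v ≡ true

    OtherNeighbour : Fin n → Fin n → Set
    OtherNeighbour v t = (R t ∧ adj G v t) ≡ true × t ≢ partner v

    other? : ∀ v → Dec (∃ (OtherNeighbour v))
    other? v = any? (λ t → ((R t ∧ adj G v t) ≟ᵇ true) ×-dec ¬? (t ≟ partner v))

    -- The fallback v is never used: other-spec shows a witness exists for every Core vertex.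
    other : Fin n → Fin n
    other v with other? v
    ... | yes (t , _) = t
    ... | no _        = v

    other-spec : ∀ {v} → Core v → OtherNeighbour v (other v)
    other-spec {v} (Rv , _) with other? v
    ... | yes (_ , spec) = spec
    ... | no none = ⊥-elim (non-leaf⇒other-neighbour (R-stuck v) Rv (R-closed v _ Rv (partner-F₀ v))
                                                      (F₀-adj v _ (partner-F₀ v)) only-partner)
      where
      only-partner : ∀ t → (R t ∧ adj G v t) ≡ true → t ≡ partner v
      only-partner t e with t ≟ partner v
      ... | yes t≡p = t≡p
      ... | no t≢p  = ⊥-elim (none (t , e , t≢p))

    other-R : ∀ {v} → Core v → R (other v) ≡ true
    other-R = proj₁ ∘ ∧-true⁻ ∘ proj₁ ∘ other-spec

    other-adj : ∀ {v} → Core v → adj G v (other v) ≡ true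
    other-adj = proj₂ ∘ ∧-true⁻ ∘ proj₁ ∘ other-spec

    other∉I : ∀ {v} → Core v → I (other v) ≡ false
    other∉I {v} v-core@(_ , Iv) with I (other v) in It
    ... | false = refl
    ... | true with () ← trans (sym (I-independent v _ Iv It)) (other-adj v-core)

    next : Fin n → Fin n
    next v = partner (other v)

    next-Core : ∀ {v} → Core v → Core (next v)
    next-Core {v} v-core with F₀-covered (other v) (next v) (partner-F₀ (other v))
    ... | inj₂ I-next = R-closed _ _ (other-R v-core) (partner-F₀ (other v)) , I-next
    ... | inj₁ I-other with () ← trans (sym I-other) (other∉I v-core)

    module Cycle (y : Fin n) (y-core : Core y) (e : ℕ) (y-periodic : fold y next (suc e) ≡ y) where

      OnCycle : Fin n → Set
      OnCycle v = ∃[ k ] fold y next k ≡ v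

      onCycle? : ∀ v → Dec (OnCycle v)
      onCycle? v = map′ (λ (k , eq) → toℕ k , eq) below-period (any? (λ (k : Fin (suc e)) → fold y next (toℕ k) ≟ v))
        where
        below-period : OnCycle v → ∃[ k ] fold y next (toℕ {suc e} k) ≡ v
        below-period (k , eq) = fromℕ< (m%n<n k (suc e)) ,
          trans (cong (fold y next) (toℕ-fromℕ< (m%n<n k (suc e)))) (trans (sym (fold-mod next (suc e) y-periodic k)) eq)

      onCycle⇒Core : ∀ {v} → OnCycle v → Core v
      onCycle⇒Core (k , refl) = fold-preserves Core next next-Core k y-core

      next-onCycle : ∀ {v} → OnCycle v → OnCycle (next v)
      next-onCycle (k , refl) = suc k , refl

      other∉cycle : ∀ {v} → OnCycle v → ¬ OnCycle (other v)
      other∉cycle v-on o-on with () ← trans (sym (proj₂ (onCycle⇒Core o-on))) (other∉I (onCycle⇒Core v-on))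

      cycle-periodic : ∀ {v} → OnCycle v → fold v next (suc e) ≡ v
      cycle-periodic (k , refl) = begin
        fold (fold y next k) next (suc e)   ≡⟨ fold-+ y next (suc e) ⟨
        fold y next (suc e + k)             ≡⟨ cong (fold y next) (+-comm (suc e) k) ⟩
        fold y next (k + suc e)             ≡⟨ fold-+ y next k ⟩
        fold (fold y next (suc e)) next k   ≡⟨ cong (λ z → fold z next k) y-periodic ⟩
        fold y next k                       ∎
        where open ≡-Reasoning

      next-injective : ∀ {a b} → OnCycle a → OnCycle b → next a ≡ next b → a ≡ b
      next-injective {a} {b} a-on b-on eq = begin
        a                        ≡⟨ cycle-periodic a-on ⟨
        fold a next (suc e)      ≡⟨ fold-suc′ next a e ⟩
        fold (next a) next e     ≡⟨ cong (λ z → fold z next e) eq ⟩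
        fold (next b) next e     ≡⟨ fold-suc′ next b e ⟨
        fold b next (suc e)      ≡⟨ cycle-periodic b-on ⟩
        b                        ∎
        where open ≡-Reasoning

      next-surjective : ∀ {v} → OnCycle v → ∃[ c ] (OnCycle c × next c ≡ v)
      next-surjective {v} v-on@(k , refl) = fold v next e , (e + k , fold-+ y next e) , cycle-periodic v-on

      -- F₀ switched along the cycle: each cycle vertex v is rematched to other v, whose old
      -- F₀-partner next v is again on the cycle.
      Swapped : Fin n → Fin n → Set
      Swapped a b = (OnCycle a × other a ≡ b) ⊎ (OnCycle b × other b ≡ a) ⊎ (¬ OnCycle a × ¬ OnCycle b × F₀ a b ≡ true)

      swapped : ESet n
      swapped a b = ⌊ (onCycle? a ×-dec other a ≟ b) ⊎-dec (onCycle? b ×-dec other b ≟ a) ⊎-dec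
                      (¬? (onCycle? a) ×-dec ¬? (onCycle? b) ×-dec F₀ a b ≟ᵇ true) ⌋

      swapped⇔ : ∀ {a b} → swapped a b ≡ true ⇔ Swapped a b
      swapped⇔ = isYes⇔ _

      Swapped-sym : ∀ {a b} → Swapped a b → Swapped b a
      Swapped-sym (inj₁ fwd)                     = inj₂ (inj₁ fwd)
      Swapped-sym (inj₂ (inj₁ bwd))              = inj₁ bwd
      Swapped-sym (inj₂ (inj₂ (a∉ , b∉ , F₀ab))) = inj₂ (inj₂ (b∉ , a∉ , trans (F₀-sym _ _) F₀ab))

      Swapped-adj : ∀ {a b} → Swapped a b → adj G a b ≡ true
      Swapped-adj (inj₁ (a-on , refl))         = other-adj (onCycle⇒Core a-on)
      Swapped-adj (inj₂ (inj₁ (b-on , refl)))  = trans (adj-sym G _ _) (other-adj (onCycle⇒Core b-on))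
      Swapped-adj (inj₂ (inj₂ (_ , _ , F₀ab))) = F₀-adj _ _ F₀ab

      Swapped-functional : ∀ {a b c} → Swapped a b → Swapped a c → b ≡ c
      Swapped-functional (inj₁ (_ , refl)) (inj₁ (_ , refl)) = refl
      Swapped-functional (inj₁ (a-on , _)) (inj₂ (inj₁ (c-on , refl))) = ⊥-elim (other∉cycle c-on a-on)
      Swapped-functional (inj₂ (inj₁ (b-on , refl))) (inj₁ (a-on , _)) = ⊥-elim (other∉cycle b-on a-on)
      Swapped-functional (inj₁ (a-on , _)) (inj₂ (inj₂ (a∉ , _))) = ⊥-elim (a∉ a-on)
      Swapped-functional (inj₂ (inj₂ (a∉ , _))) (inj₁ (a-on , _)) = ⊥-elim (a∉ a-on)
      Swapped-functional (inj₂ (inj₁ (b-on , refl))) (inj₂ (inj₁ (c-on , b≡c))) =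
        next-injective b-on c-on (cong partner (sym b≡c))
      Swapped-functional (inj₂ (inj₁ (b-on , refl))) (inj₂ (inj₂ (_ , c∉ , F₀ac))) =
        ⊥-elim (c∉ (subst OnCycle (sym (partner-unique F₀ac)) (next-onCycle b-on)))
      Swapped-functional (inj₂ (inj₂ (_ , b∉ , F₀ab))) (inj₂ (inj₁ (c-on , refl))) =
        ⊥-elim (b∉ (subst OnCycle (sym (partner-unique F₀ab)) (next-onCycle c-on)))
      Swapped-functional (inj₂ (inj₂ (_ , _ , F₀ab))) (inj₂ (inj₂ (_ , _ , F₀ac))) = F₀-functional _ _ _ F₀ab F₀ac

      Swapped-total : ∀ a → ∃[ b ] Swapped a b
      Swapped-total a with onCycle? a | onCycle? (partner a)
      ... | yes a-on | _ = other a , inj₁ (a-on , refl)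
      ... | no a∉ | no p∉ = partner a , inj₂ (inj₂ (a∉ , p∉ , partner-F₀ a))
      ... | no _  | yes p-on with next-surjective p-on
      ...   | c , c-on , next-c≡p = c , inj₂ (inj₁ (c-on , other-c≡a))
        where
        other-c≡a : other c ≡ a
        other-c≡a = trans (sym (partner-involutive (other c))) (trans (cong partner next-c≡p) (partner-involutive a))

      swapped-perfect : IsPerfectMatching G swapped
      swapped-perfect =
        ((λ i j → Swapped-adj ∘ to) ,
         (λ i j → bool-ext (from ∘ Swapped-sym ∘ to) (from ∘ Swapped-sym ∘ to)) ,
         (λ i j k e e′ → Swapped-functional (to e) (to e′))) ,
        (λ a → map₂ from (Swapped-total a))
        where
        to : ∀ {a b} → swapped a b ≡ true → Swapped a b
        to = Equivalence.to swapped⇔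
        from : ∀ {a b} → Swapped a b → swapped a b ≡ true
        from = Equivalence.from swapped⇔

      uniqueness-violated : ⊥
      uniqueness-violated = proj₂ (other-spec y-core) (partner-unique (trans (sym (F₀-unique swapped swapped-perfect y (other y)))
                                                                (Equivalence.from swapped⇔ (inj₁ ((0 , refl) , refl)))))

    R-nonempty⇒Core : ∀ {r} → R r ≡ true → ∃ Core
    R-nonempty⇒Core {r} Rr with I r in Ir | F₀-covered r (partner r) (partner-F₀ r)
    ... | true  | _             = r , Rr , Ir
    ... | false | inj₂ I-partner = partner r , R-closed r _ Rr (partner-F₀ r) , I-partner
    ... | false | inj₁ ()

    -- By pigeonhole the walk from a Core vertex revisits a vertex; that vertex is periodic.
    R-empty : IsEmptySet R
    R-empty r with R r in Rr
    ... | false = refl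
    ... | true with R-nonempty⇒Core Rr
    ...   | s , s-core with pigeonhole (n<1+n n) (λ k → fold s next (toℕ k))
    ...     | i , j , i<j , same = ⊥-elim (Cycle.uniqueness-violated y (fold-preserves Core next next-Core (toℕ i) s-core) e y-periodic)
      where
      y = fold s next (toℕ i)
      e = toℕ j ∸ suc (toℕ i)
      y-periodic : fold y next (suc e) ≡ y
      y-periodic = begin
        fold y next (suc e)             ≡⟨ fold-+ s next (suc e) ⟨
        fold s next (suc e + toℕ i)     ≡⟨ cong (fold s next) (+-suc e (toℕ i)) ⟨
        fold s next (e + suc (toℕ i))   ≡⟨ cong (fold s next) (m∸n+n≡m i<j) ⟩
        fold s next (toℕ j)             ≡⟨ same ⟨
        y                               ∎
        where open ≡-Reasoning

  emptied⇒KE×uniquePM : ∀ {M R} → LeafRemoval G fullSet M R → IsEmptySet R → IsKE G × HasUniquePM G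
  emptied⇒KE×uniquePM {M} run R-empty with run-leaves run
  ... | leaves , _ , leaves-indep , leaves-size =
    (L , L , α≡L , μ≡L , L+L≡n) , output M , output-perfect , output-unique
    where
    L = length M
    n≡2L : n ≡ 2 * L
    n≡2L = trans (sym count-full) (run-count run R-empty)
    L+L≡n : L + L ≡ n
    L+L≡n = trans (cong (L +_) (sym (+-identityʳ L))) (sym n≡2L)
    output-perfect : IsPerfectMatching G (output M)
    output-perfect with emptied⇒output-perfect run R-empty
    ... | (output-matching , _) , output-saturates = output-matching , λ i → output-saturates i refl
    output-size : edgeCount (output M) ≡ L
    output-size = *-cancelˡ-≡ _ _ 2 (trans (sym (perfect-matching-size output-perfect)) n≡2L)
    independent+matching≤2L : ∀ {J F} → IsIndependent G J → IsMatching G F → count J + edgeCount F ≤ L + L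
    independent+matching≤2L {J} {F} J-indep F-matching =
      subst (count J + edgeCount F ≤_) (trans count-full (sym L+L≡n))
            (independent+matching≤ (matchingOn-full F-matching) (λ _ _ → refl) J-indep)
    α≡L : IsAlpha G L
    α≡L = (leaves , leaves-indep , leaves-size) , λ J J-indep →
      +-cancelʳ-≤ L _ _ (subst (λ e → count J + e ≤ L + L) output-size (independent+matching≤2L J-indep (proj₁ output-perfect)))
    μ≡L : IsMu G L
    μ≡L = (output M , proj₁ output-perfect , output-size) , λ F F-matching →
      +-cancelˡ-≤ L _ _ (subst (λ c → c + edgeCount F ≤ L + L) leaves-size (independent+matching≤2L leaves-indep F-matching))
    output-unique : ∀ F → IsPerfectMatching G F → ∀ i j → F i j ≡ output M i j
    output-unique F F-perfect i j = bool-ext (from′ ∘ to) (from ∘ to′)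
      where
      open Equivalence (emptied⇒perfect-matching≡output run R-empty F-perfect (λ _ _ _ _ → refl) {i} {j} refl)
      open Equivalence (isYes⇔ (InOutput? M i j)) renaming (to to to′; from to from′)

  KE×uniquePM⇒emptied : ∀ {M R} → LeafRemoval G fullSet M R → IsKE G × HasUniquePM G → IsEmptySet R
  KE×uniquePM⇒emptied {R = R} run (KE , F₀ , F₀-perfect , F₀-unique) with KE⇒independent-cover KE F₀-perfect
  ... | I , I-independent , F₀-covered =
    AlternatingCycle.R-empty I F₀ R I-independent F₀-perfect F₀-unique F₀-covered
      (run-closed run F₀-perfect (λ _ _ _ _ → refl)) (run-stuck run)

theorem3 : ∀ {n} (G : Graph n) (M : List (Fin n × Fin n)) (R : VSet n) →
    LeafRemoval G fullSet M R →
    (IsEmptySet R ⇔ (IsKE G × HasUniquePM G)) ×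
    (IsEmptySet R → ∀ F → IsPerfectMatching G F →
      ∀ i j → (F i j ≡ true ⇔ InOutput M i j))
theorem3 G M R run =
  mk⇔ (emptied⇒KE×uniquePM G run) (KE×uniquePM⇒emptied G run) ,
  λ R-empty F F-perfect i j → emptied⇒perfect-matching≡output G run R-empty F-perfect (λ _ _ _ _ → refl) refl
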